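{- Let $h$ be a positive integer, $0<\alpha<1/2$, let $V$ be a finite set and let $V_1,\dots,V_m\subset V$ with $|V_i|\ge\alpha|V|$ for all $i$. If $m\ge 2h/\alpha$, then there exists $I\subset[m]$ with $|I|=h$ such that $$\Big|\bigcap_{i\in I}V_i\Big|\ge(\alpha/12)^{h+1}|V|.$$
   Formalization: The parameter α ranges over the rationals. -}

module Defs where

open import Data.Nat using (ℕ; zero; suc)
open import Data.Integer using (+_)
open import Data.Rational using (ℚ; _/_; _*_; 1ℚ)
open import Data.Fin using (Fin; zero; suc)
open import Data.Fin.Subset using (Subset; ⊤; _∩_; inside; outside)
open import Data.Vec using (_∷_)

ℕ→ℚ : ℕ → ℚ
ℕ→ℚ n = + n / 1

_^ℚ_ : ℚ → ℕ → ℚ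
q ^ℚ zero = 1ℚ
q ^ℚ suc k = q * (q ^ℚ k)

-- ⋂[ I ] V  =  ⋂_{i ∈ I} V i  (subsets of Fin n indexed by Fin m);
-- the empty intersection is the whole set ⊤.
⋂[_]_ : ∀ {m n} → Subset m → (Fin m → Subset n) → Subset n
⋂[_]_ {zero} I V = ⊤
⋂[_]_ {suc m} (inside ∷ I) V = V zero ∩ (⋂[ I ] (λ i → V (suc i)))
⋂[_]_ {suc m} (outside ∷ I) V = ⋂[ I ] (λ i → V (suc i))

{-# OPTIONS --safe #-}
-- Write α = p/q and call a point heavy if it lies in at least 3αm/4 of the sets.
-- Double counting gives Σ_v deg v = Σ_i |V_i| ≥ αmn, and deg v ≤ m, so at least
-- αn/4 points are heavy.  Now choose the sets greedily: if I has been chosen,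
-- |I| < h, and W is the set of heavy points of ⋂_{i∈I} V_i, then every point of W
-- lies in at least 3αm/4 - |I| ≥ αm/4 unused sets (as 2h ≤ αm), so by averaging
-- some unused V_i contains an α/4 fraction of W.  After h steps this leaves
-- (α/4)^{h+1}|V| ≥ (α/12)^{h+1}|V| points in ⋂_{i∈I} V_i.
module Submission where

module Counting where

  open import Data.Bool using (true; false; if_then_else_; _∧_; not)
  open import Data.Bool.Properties using (T-≡)
  open import Data.Fin using (Fin; zero; suc)
  open import Data.Fin.Properties using (nonZeroIndex)
  open import Data.Fin.Subset
  open import Data.Fin.Subset.Properties
  open import Data.Nat
  open import Data.Nat.Properties
  open import Data.Nat.Tactic.RingSolver using (solve-∀)
  open import Data.Product using (∃-syntax; _×_; _,_; proj₁; proj₂)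
  open import Data.Sum using (_⊎_; inj₁; inj₂)
  open import Data.Vec using (_∷_; []; lookup; tabulate; here; there)
  open import Data.Vec.Properties using (lookup-zipWith; lookup-map; lookup∘tabulate; []=⇒lookup; lookup⇒[]=)
  open import Function using (_∘_; Equivalence)
  open import Relation.Binary.PropositionalEquality using (_≡_; refl; sym; trans; cong; cong₂; module ≡-Reasoning)
  open import Relation.Nullary using (yes; no; contradiction)
  open import Algebra.Properties.CommutativeSemigroup *-commutativeSemigroup
    using (x∙yz≈y∙xz; x∙yz≈z∙xy; x∙yz≈xz∙y; x∙yz≈z∙yx; x∙yz≈y∙zx; xy∙z≈y∙xz)
  open import Algebra.Properties.Semiring.Sum +-*-semiring
    using (sum-syntax; ∑-comm; ∑-distrib-+; *-distribˡ-sum; *-distribʳ-sum; sum-cong-≗)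

  open import Defs

  private variable m n : ℕ

  χ : Subset n → Fin n → ℕ
  χ p v = if lookup p v then 1 else 0

  ∣p∣≡∑χ : ∀ (p : Subset n) → ∣ p ∣ ≡ ∑[ v < n ] χ p v
  ∣p∣≡∑χ []            = refl
  ∣p∣≡∑χ (inside  ∷ p) = cong suc (∣p∣≡∑χ p)
  ∣p∣≡∑χ (outside ∷ p) = ∣p∣≡∑χ p

  χ-∩ : ∀ (p q : Subset n) v → χ (p ∩ q) v ≡ χ p v * χ q v
  χ-∩ p q v rewrite lookup-zipWith _∧_ v p q with lookup p v | lookup q v
  ... | true  | true  = refl
  ... | true  | false = refl
  ... | false | _     = refl

  χ-∁ : ∀ (p : Subset n) v → χ (∁ p) v + χ p v ≡ 1
  χ-∁ p v rewrite lookup-map v not p with lookup p v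
  ... | true  = refl
  ... | false = refl

  χ-∈ : ∀ (p : Subset n) {v} → v ∈ p → χ p v ≡ 1
  χ-∈ p v∈p = cong (λ x → if x then 1 else 0) ([]=⇒lookup v∈p)

  χ≤1 : ∀ (p : Subset n) v → χ p v ≤ 1
  χ≤1 p v with lookup p v
  ... | true  = ≤-refl
  ... | false = z≤n

  ∑-mono-≤ : ∀ {f g : Fin n → ℕ} → (∀ i → f i ≤ g i) → ∑[ i < n ] f i ≤ ∑[ i < n ] g i
  ∑-mono-≤ {zero}  f≤g = z≤n
  ∑-mono-≤ {suc n} f≤g = +-mono-≤ (f≤g zero) (∑-mono-≤ (f≤g ∘ suc))

  ∑-const : ∀ n c → ∑[ i < n ] c ≡ n * c
  ∑-const zero    c = refl
  ∑-const (suc n) c = cong (c +_) (∑-const n c)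

  ∈-⋂⁺ : ∀ {I : Subset m} {V : Fin m → Subset n} {v} → (∀ {i} → i ∈ I → v ∈ V i) → v ∈ ⋂[ I ] V
  ∈-⋂⁺ {I = []}          v∈V = ∈⊤
  ∈-⋂⁺ {I = inside  ∷ I} v∈V = x∈p∩q⁺ (v∈V here , ∈-⋂⁺ (v∈V ∘ there))
  ∈-⋂⁺ {I = outside ∷ I} v∈V = ∈-⋂⁺ (v∈V ∘ there)

  ∈-⋂⁻ : ∀ {I : Subset m} {V : Fin m → Subset n} {v i} → v ∈ ⋂[ I ] V → i ∈ I → v ∈ V i
  ∈-⋂⁻ {I = inside  ∷ I} {V} v∈⋂ here       = proj₁ (x∈p∩q⁻ (V zero) _ v∈⋂)
  ∈-⋂⁻ {I = inside  ∷ I} {V} v∈⋂ (there i∈I) = ∈-⋂⁻ (proj₂ (x∈p∩q⁻ (V zero) _ v∈⋂)) i∈I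
  ∈-⋂⁻ {I = outside ∷ I}     v∈⋂ (there i∈I) = ∈-⋂⁻ v∈⋂ i∈I

  W∩⋂[I]∩Vi⊆W∩⋂[I∪⁅i⁆] : ∀ (W : Subset n) (I : Subset m) (V : Fin m → Subset n) i →
                    (W ∩ ⋂[ I ] V) ∩ V i ⊆ W ∩ ⋂[ I ∪ ⁅ i ⁆ ] V
  W∩⋂[I]∩Vi⊆W∩⋂[I∪⁅i⁆] W I V i {v} v∈ = x∈p∩q⁺ (v∈W , ∈-⋂⁺ (v∈V ∘ x∈p∪q⁻ I ⁅ i ⁆))
    where
    v∈W∩⋂ = proj₁ (x∈p∩q⁻ (W ∩ ⋂[ I ] V) (V i) v∈)
    v∈W = proj₁ (x∈p∩q⁻ W (⋂[ I ] V) v∈W∩⋂)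
    v∈V : ∀ {j} → j ∈ I ⊎ j ∈ ⁅ i ⁆ → v ∈ V j
    v∈V (inj₁ j∈I)   = ∈-⋂⁻ (proj₂ (x∈p∩q⁻ W (⋂[ I ] V) v∈W∩⋂)) j∈I
    v∈V (inj₂ j∈⁅i⁆) rewrite x∈⁅y⁆⇒x≡y i j∈⁅i⁆ = proj₂ (x∈p∩q⁻ (W ∩ ⋂[ I ] V) (V i) v∈)

  ∣p∪⁅x⁆∣≡1+∣p∣ : ∀ (p : Subset n) {x} → x ∉ p → ∣ p ∪ ⁅ x ⁆ ∣ ≡ suc ∣ p ∣
  ∣p∪⁅x⁆∣≡1+∣p∣ (outside ∷ p) {zero}  x∉p = cong (suc ∘ ∣_∣) (∪-identityʳ p)
  ∣p∪⁅x⁆∣≡1+∣p∣ (inside  ∷ p) {zero}  x∉p = contradiction here x∉p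
  ∣p∪⁅x⁆∣≡1+∣p∣ (outside ∷ p) {suc x} x∉p = ∣p∪⁅x⁆∣≡1+∣p∣ p (x∉p ∘ there)
  ∣p∪⁅x⁆∣≡1+∣p∣ (inside  ∷ p) {suc x} x∉p = cong suc (∣p∪⁅x⁆∣≡1+∣p∣ p (x∉p ∘ there))

  ∣p∣<n⇒Nonempty∁p : ∀ (p : Subset n) → ∣ p ∣ < n → Nonempty (∁ p)
  ∣p∣<n⇒Nonempty∁p {n} p ∣p∣<n with nonempty? (∁ p)
  ... | yes ∁p≢∅ = ∁p≢∅
  ... | no  ∁p≡∅ = contradiction ∣∁p∣≡0 (m>n⇒m∸n≢0 ∣p∣<n)
    where
    ∣∁p∣≡0 : n ∸ ∣ p ∣ ≡ 0
    ∣∁p∣≡0 = begin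
      n ∸ ∣ p ∣ ≡⟨ ∣∁p∣≡n∸∣p∣ p ⟨
      ∣ ∁ p ∣   ≡⟨ cong ∣_∣ (Empty-unique ∁p≡∅) ⟩
      ∣ ⊥ {n} ∣ ≡⟨ ∣⊥∣≡0 n ⟩
      0         ∎
      where open ≡-Reasoning

  ∃-max : ∀ (J : Subset m) (f : Fin m → ℕ) → Nonempty J → ∃[ i ] i ∈ J × (∀ {j} → j ∈ J → f j ≤ f i)
  ∃-max (s ∷ J) f J≢∅ with nonempty? J
  ∃-max (s ∷ J) f (zero , here) | no J≡∅ = zero , here , λ where
    here        → ≤-refl
    (there j∈J) → contradiction (_ , j∈J) J≡∅
  ∃-max (s ∷ J) f (suc k , there k∈J) | no J≡∅ = contradiction (k , k∈J) J≡∅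
  ∃-max (s ∷ J) f _ | yes J≢∅ with ∃-max J (f ∘ suc) J≢∅
  ∃-max (outside ∷ J) f _ | yes _ | i , i∈J , max = suc i , there i∈J , λ { (there j∈J) → max j∈J }
  ∃-max (inside  ∷ J) f _ | yes _ | i , i∈J , max with f zero ≤? f (suc i)
  ... | yes f0≤fi = suc i , there i∈J , λ where
    here        → f0≤fi
    (there j∈J) → max j∈J
  ... | no  f0≰fi = zero , here , λ where
    here        → ≤-refl
    (there j∈J) → ≤-trans (max j∈J) (<⇒≤ (≰⇒> f0≰fi))

  χ*-monoʳ-≤ : ∀ (p : Subset n) v {x y} → (v ∈ p → x ≤ y) → χ p v * x ≤ χ p v * y
  χ*-monoʳ-≤ p v x≤y with lookup p v in eq
  ... | true  = +-monoˡ-≤ 0 (x≤y (lookup⇒[]= v p eq))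
  ... | false = z≤n

  ∑≤∑χ∁*+∣p∣*c : ∀ (p : Subset n) (f : Fin n → ℕ) {c} → (∀ i → f i ≤ c) →
                  ∑[ i < n ] f i ≤ ∑[ i < n ] (χ (∁ p) i * f i) + ∣ p ∣ * c
  ∑≤∑χ∁*+∣p∣*c {n} p f {c} f≤c = begin
    ∑[ i < n ] f i
      ≡⟨ sum-cong-≗ split ⟩
    ∑[ i < n ] (χ (∁ p) i * f i + χ p i * f i)
      ≡⟨ ∑-distrib-+ (λ i → χ (∁ p) i * f i) (λ i → χ p i * f i) ⟩
    ∑[ i < n ] (χ (∁ p) i * f i) + ∑[ i < n ] (χ p i * f i)
      ≤⟨ +-monoʳ-≤ _ (∑-mono-≤ (λ i → *-monoʳ-≤ (χ p i) (f≤c i))) ⟩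
    ∑[ i < n ] (χ (∁ p) i * f i) + ∑[ i < n ] (χ p i * c)
      ≡⟨ cong (_ +_) (trans (cong (_* c) (∣p∣≡∑χ p)) (*-distribʳ-sum c (χ p))) ⟨
    ∑[ i < n ] (χ (∁ p) i * f i) + ∣ p ∣ * c
      ∎
    where
    open ≤-Reasoning
    split : ∀ i → f i ≡ χ (∁ p) i * f i + χ p i * f i
    split i = begin-equality
      f i                              ≡⟨ *-identityˡ (f i) ⟨
      1 * f i                          ≡⟨ cong (_* f i) (χ-∁ p i) ⟨
      (χ (∁ p) i + χ p i) * f i        ≡⟨ *-distribʳ-+ (f i) (χ (∁ p) i) (χ p i) ⟩
      χ (∁ p) i * f i + χ p i * f i    ∎

  ∑χ*≤n*max : ∀ (p : Subset n) (f : Fin n → ℕ) → Nonempty p →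
              ∃[ i ] i ∈ p × ∑[ j < n ] (χ p j * f j) ≤ n * f i
  ∑χ*≤n*max {n} p f p≢∅ with ∃-max p f p≢∅
  ... | i , i∈p , max = i , i∈p , (begin
    ∑[ j < n ] (χ p j * f j)  ≤⟨ ∑-mono-≤ (λ j → ≤-trans (χ*-monoʳ-≤ p j max) (*-monoˡ-≤ (f i) (χ≤1 p j))) ⟩
    ∑[ j < n ] (1 * f i)      ≡⟨ ∑-const n (1 * f i) ⟩
    n * (1 * f i)             ≡⟨ cong (n *_) (*-identityˡ (f i)) ⟩
    n * f i                   ∎)
    where open ≤-Reasoning

  deg : (Fin m → Subset n) → Fin n → ℕ
  deg {m} V v = ∑[ i < m ] χ (V i) v

  deg≤m : ∀ (V : Fin m → Subset n) v → deg V v ≤ m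
  deg≤m {m} V v = begin
    deg V v         ≤⟨ ∑-mono-≤ (λ i → χ≤1 (V i) v) ⟩
    ∑[ i < m ] 1    ≡⟨ ∑-const m 1 ⟩
    m * 1           ≡⟨ *-identityʳ m ⟩
    m               ∎
    where open ≤-Reasoning

  ∑deg≡∑∣V∣ : ∀ (V : Fin m → Subset n) → ∑[ v < n ] deg V v ≡ ∑[ i < m ] ∣ V i ∣
  ∑deg≡∑∣V∣ {m} {n} V = begin
    ∑[ v < n ] ∑[ i < m ] χ (V i) v  ≡⟨ ∑-comm (λ v i → χ (V i) v) ⟩
    ∑[ i < m ] ∑[ v < n ] χ (V i) v  ≡⟨ sum-cong-≗ (sym ∘ ∣p∣≡∑χ ∘ V) ⟩
    ∑[ i < m ] ∣ V i ∣               ∎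
    where open ≡-Reasoning

  deg-∩ : ∀ (W : Subset n) (V : Fin m → Subset n) v → deg (λ i → W ∩ V i) v ≡ χ W v * deg V v
  deg-∩ W V v = trans (sum-cong-≗ (λ i → χ-∩ W (V i) v)) (sym (*-distribˡ-sum (χ W v) (λ i → χ (V i) v)))

  ∣W∣*b≤a*∑∣W∩V∣ : ∀ (V : Fin m → Subset n) (W : Subset n) {a b} → (∀ {v} → v ∈ W → b ≤ a * deg V v) →
                   ∣ W ∣ * b ≤ a * ∑[ i < m ] ∣ W ∩ V i ∣
  ∣W∣*b≤a*∑∣W∩V∣ {m} {n} V W {a} {b} dense = begin
    ∣ W ∣ * b                                    ≡⟨ cong (_* b) (∣p∣≡∑χ W) ⟩
    (∑[ v < n ] χ W v) * b                       ≡⟨ *-distribʳ-sum b (χ W) ⟩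
    ∑[ v < n ] (χ W v * b)                       ≤⟨ ∑-mono-≤ (λ v → χ*-monoʳ-≤ W v dense) ⟩
    ∑[ v < n ] (χ W v * (a * deg V v))           ≡⟨ sum-cong-≗ (λ v → trans (x∙yz≈y∙xz (χ W v) a _) (cong (a *_) (sym (deg-∩ W V v)))) ⟩
    ∑[ v < n ] (a * deg (λ i → W ∩ V i) v)       ≡⟨ *-distribˡ-sum a (deg (λ i → W ∩ V i)) ⟨
    a * ∑[ v < n ] deg (λ i → W ∩ V i) v         ≡⟨ cong (a *_) (∑deg≡∑∣V∣ (λ i → W ∩ V i)) ⟩
    a * ∑[ i < m ] ∣ W ∩ V i ∣                   ∎
    where open ≤-Reasoning

  -- Densities are scaled by a: each point of W lies in at least b/a of the sets,
  -- of which at most ∣ I ∣ are already used, and V i keeps a c/a share of W.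
  greedy-step : ∀ (V : Fin m → Subset n) (W : Subset n) (I : Subset m) {a b c} →
                ∣ I ∣ < m → c * m + a * ∣ I ∣ ≤ b → (∀ {v} → v ∈ W → b ≤ a * deg V v) →
                ∃[ i ] i ∉ I × ∣ W ∣ * c ≤ a * ∣ W ∩ V i ∣
  greedy-step {m} V W I {a} {b} {c} ∣I∣<m c*m+a*∣I∣≤b dense
    with ∑χ*≤n*max (∁ I) (λ j → ∣ W ∩ V j ∣) (∣p∣<n⇒Nonempty∁p I ∣I∣<m)
  ... | i , i∈∁I , ∑≤m*max =
    i , x∈∁p⇒x∉p i∈∁I ,
    *-cancelʳ-≤ (∣ W ∣ * c) (a * ∣ W ∩ V i ∣) m {{nonZeroIndex i}}
      (+-cancelʳ-≤ (a * (∣ I ∣ * ∣ W ∣)) (∣ W ∣ * c * m) (a * ∣ W ∩ V i ∣ * m) chain)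
    where
    open ≤-Reasoning
    chain : ∣ W ∣ * c * m + a * (∣ I ∣ * ∣ W ∣) ≤ a * ∣ W ∩ V i ∣ * m + a * (∣ I ∣ * ∣ W ∣)
    chain = begin
      ∣ W ∣ * c * m + a * (∣ I ∣ * ∣ W ∣)
        ≡⟨ cong₂ _+_ (*-assoc ∣ W ∣ c m) (x∙yz≈z∙xy a ∣ I ∣ ∣ W ∣) ⟩
      ∣ W ∣ * (c * m) + ∣ W ∣ * (a * ∣ I ∣)
        ≡⟨ *-distribˡ-+ ∣ W ∣ (c * m) (a * ∣ I ∣) ⟨
      ∣ W ∣ * (c * m + a * ∣ I ∣)
        ≤⟨ *-monoʳ-≤ ∣ W ∣ c*m+a*∣I∣≤b ⟩
      ∣ W ∣ * b
        ≤⟨ ∣W∣*b≤a*∑∣W∩V∣ V W {a} dense ⟩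
      a * ∑[ j < m ] ∣ W ∩ V j ∣
        ≤⟨ *-monoʳ-≤ a (∑≤∑χ∁*+∣p∣*c I (λ j → ∣ W ∩ V j ∣) (λ j → ∣p∩q∣≤∣p∣ W (V j))) ⟩
      a * (∑[ j < m ] (χ (∁ I) j * ∣ W ∩ V j ∣) + ∣ I ∣ * ∣ W ∣)
        ≤⟨ *-monoʳ-≤ a (+-monoˡ-≤ (∣ I ∣ * ∣ W ∣) ∑≤m*max) ⟩
      a * (m * ∣ W ∩ V i ∣ + ∣ I ∣ * ∣ W ∣)
        ≡⟨ *-distribˡ-+ a (m * ∣ W ∩ V i ∣) (∣ I ∣ * ∣ W ∣) ⟩
      a * (m * ∣ W ∩ V i ∣) + a * (∣ I ∣ * ∣ W ∣)
        ≡⟨ cong (_+ a * (∣ I ∣ * ∣ W ∣)) (x∙yz≈xz∙y a m ∣ W ∩ V i ∣) ⟩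
      a * ∣ W ∩ V i ∣ * m + a * (∣ I ∣ * ∣ W ∣)
        ∎

  greedy-iterate : ∀ (w : Subset m → ℕ) {c K} h →
                   (∀ I → ∣ I ∣ < h → ∃[ i ] i ∉ I × w I * c ≤ K * w (I ∪ ⁅ i ⁆)) →
                   ∃[ I ] ∣ I ∣ ≡ h × w ⊥ * c ^ h ≤ K ^ h * w I
  greedy-iterate {m} w zero _ = ⊥ , ∣⊥∣≡0 m , ≤-reflexive (trans (*-identityʳ (w ⊥)) (sym (*-identityˡ (w ⊥))))
  greedy-iterate w {c} {K} (suc h) step with greedy-iterate w h (λ I ∣I∣<h → step I (m<n⇒m<1+n ∣I∣<h))
  ... | I , refl , w⊥*cʰ≤Kʰ*wI with step I ≤-refl
  ...   | i , i∉I , wI*c≤K*wI' = I ∪ ⁅ i ⁆ , ∣p∪⁅x⁆∣≡1+∣p∣ I i∉I , (begin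
    w ⊥ * (c * c ^ h)            ≡⟨ x∙yz≈xz∙y (w ⊥) c (c ^ h) ⟩
    w ⊥ * c ^ h * c              ≤⟨ *-monoˡ-≤ c w⊥*cʰ≤Kʰ*wI ⟩
    K ^ h * w I * c              ≡⟨ *-assoc (K ^ h) (w I) c ⟩
    K ^ h * (w I * c)            ≤⟨ *-monoʳ-≤ (K ^ h) wI*c≤K*wI' ⟩
    K ^ h * (K * w (I ∪ ⁅ i ⁆))  ≡⟨ x∙yz≈y∙xz (K ^ h) K _ ⟩
    K * (K ^ h * w (I ∪ ⁅ i ⁆))  ≡⟨ *-assoc K (K ^ h) _ ⟨
    K * K ^ h * w (I ∪ ⁅ i ⁆)    ∎)
    where open ≤-Reasoning

  above : ℕ → (Fin n → ℕ) → Subset n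
  above b f = tabulate (λ v → b ≤ᵇ f v)

  lookup-above : ∀ b (f : Fin n → ℕ) v → lookup (above b f) v ≡ (b ≤ᵇ f v)
  lookup-above b f v = lookup∘tabulate _ v

  ∈-above⁺ : ∀ b (f : Fin n → ℕ) {v} → b ≤ f v → v ∈ above b f
  ∈-above⁺ b f {v} b≤fv = lookup⇒[]= v (above b f) (trans (lookup-above b f v) (Equivalence.to T-≡ (≤⇒≤ᵇ b≤fv)))

  ∈-above⁻ : ∀ b (f : Fin n → ℕ) {v} → v ∈ above b f → b ≤ f v
  ∈-above⁻ b f {v} v∈ = ≤ᵇ⇒≤ b (f v) (Equivalence.from T-≡ (trans (sym (lookup-above b f v)) ([]=⇒lookup v∈)))

  ∑≤∣above∣*max+n*b : ∀ (f : Fin n → ℕ) {M} b → (∀ v → f v ≤ M) → ∑[ v < n ] f v ≤ ∣ above b f ∣ * M + n * b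
  ∑≤∣above∣*max+n*b {n} f {M} b f≤M = begin
    ∑[ v < n ] f v                                   ≤⟨ ∑-mono-≤ f≤χ*M+b ⟩
    ∑[ v < n ] (χ A v * M + b)                       ≡⟨ ∑-distrib-+ (λ v → χ A v * M) (λ _ → b) ⟩
    ∑[ v < n ] (χ A v * M) + ∑[ v < n ] b            ≡⟨ cong₂ _+_ (sym (*-distribʳ-sum M (χ A))) (∑-const n b) ⟩
    (∑[ v < n ] χ A v) * M + n * b                   ≡⟨ cong (λ k → k * M + n * b) (∣p∣≡∑χ A) ⟨
    ∣ A ∣ * M + n * b                                ∎
    where
    open ≤-Reasoning
    A = above b f
    f≤χ*M+b : ∀ v → f v ≤ χ A v * M + b
    f≤χ*M+b v with b ≤? f v
    ... | no  b≰fv = ≤-trans (<⇒≤ (≰⇒> b≰fv)) (m≤n+m b _)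
    ... | yes b≤fv = begin
      f v            ≤⟨ f≤M v ⟩
      M              ≡⟨ *-identityˡ M ⟨
      1 * M          ≡⟨ cong (_* M) (χ-∈ A (∈-above⁺ b f b≤fv)) ⟨
      χ A v * M      ≤⟨ m≤m+n _ b ⟩
      χ A v * M + b  ∎

  p*n≤4q*∣above∣ : ∀ (V : Fin m → Subset n) {p q} .{{_ : NonZero m}} → (∀ i → p * n ≤ ∣ V i ∣ * q) →
                   p * n ≤ 4 * q * ∣ above (3 * (p * m)) (λ v → 4 * q * deg V v) ∣
  p*n≤4q*∣above∣ {m} {n} V {p} {q} p*n≤∣V∣*q =
    *-cancelˡ-≤ m (+-cancelʳ-≤ (3 * (m * (p * n))) (m * (p * n)) (m * (a * ∣ W₀ ∣)) (begin
      4 * (m * (p * n))                  ≤⟨ *-monoʳ-≤ 4 m*p*n≤∑∣V∣*q ⟩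
      4 * ((∑[ i < m ] ∣ V i ∣) * q)      ≡⟨ x∙yz≈xz∙y 4 _ q ⟩
      a * ∑[ i < m ] ∣ V i ∣              ≡⟨ cong (a *_) (∑deg≡∑∣V∣ V) ⟨
      a * ∑[ v < n ] deg V v             ≡⟨ *-distribˡ-sum a (deg V) ⟩
      ∑[ v < n ] (a * deg V v)           ≤⟨ ∑≤∣above∣*max+n*b (λ v → a * deg V v) b (λ v → *-monoʳ-≤ a (deg≤m V v)) ⟩
      ∣ W₀ ∣ * (a * m) + n * b            ≡⟨ cong₂ _+_ (x∙yz≈z∙yx ∣ W₀ ∣ a m) (trans (x∙yz≈y∙xz n 3 (p * m)) (cong (3 *_) (x∙yz≈z∙yx n p m))) ⟩
      m * (a * ∣ W₀ ∣) + 3 * (m * (p * n)) ∎))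
    where
    open ≤-Reasoning
    a = 4 * q
    b = 3 * (p * m)
    W₀ = above b (λ v → a * deg V v)
    m*p*n≤∑∣V∣*q : m * (p * n) ≤ (∑[ i < m ] ∣ V i ∣) * q
    m*p*n≤∑∣V∣*q = begin
      m * (p * n)              ≡⟨ ∑-const m (p * n) ⟨
      ∑[ i < m ] (p * n)       ≤⟨ ∑-mono-≤ p*n≤∣V∣*q ⟩
      ∑[ i < m ] (∣ V i ∣ * q)  ≡⟨ *-distribʳ-sum q (∣_∣ ∘ V) ⟨
      (∑[ i < m ] ∣ V i ∣) * q  ∎

  dense-intersection : ∀ (V : Fin m → Subset n) {h p q} .{{_ : NonZero q}} →
                       1 ≤ h → p ≤ q → 2 * h * q ≤ m * p → (∀ i → p * n ≤ ∣ V i ∣ * q) →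
                       ∃[ I ] ∣ I ∣ ≡ h × p ^ suc h * n ≤ ∣ ⋂[ I ] V ∣ * (4 * q) ^ suc h
  dense-intersection {m} {n} V {h} {p} {q} 1≤h p≤q 2hq≤mp p*n≤∣V∣*q =
    conclude (greedy-iterate w {p} {a} h step)
    where
    open ≤-Reasoning
    -- W₀ is the set of heavy points, those lying in at least (3/4)(p/q)m of the sets.
    a = 4 * q
    b = 3 * (p * m)
    W₀ = above b (λ v → a * deg V v)

    w : Subset m → ℕ
    w I = ∣ W₀ ∩ ⋂[ I ] V ∣

    h≤m : h ≤ m
    h≤m = ≤-trans (m≤n*m h 2) (*-cancelʳ-≤ (2 * h) m q (≤-trans 2hq≤mp (*-monoʳ-≤ m p≤q)))

    ∣W₀∣≤w⊥ : ∣ W₀ ∣ ≤ w ⊥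
    ∣W₀∣≤w⊥ = p⊆q⇒∣p∣≤∣q∣ {p = W₀} {q = W₀ ∩ ⋂[ ⊥ ] V} (λ v∈W₀ → x∈p∩q⁺ (v∈W₀ , ∈-⋂⁺ {I = ⊥} {V} (λ i∈⊥ → contradiction i∈⊥ ∉⊥)))

    threshold : ∀ {k} → k ≤ h → p * m + a * k ≤ b
    threshold {k} k≤h = begin
      p * m + a * k              ≤⟨ +-monoʳ-≤ (p * m) (*-monoʳ-≤ a k≤h) ⟩
      p * m + 4 * q * h          ≡⟨ cong (p * m +_) (4qh≡2[2hq] q h) ⟩
      p * m + 2 * (2 * h * q)    ≤⟨ +-monoʳ-≤ (p * m) (*-monoʳ-≤ 2 (≤-trans 2hq≤mp (≤-reflexive (*-comm m p)))) ⟩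
      p * m + 2 * (p * m)        ∎
      where
      4qh≡2[2hq] : ∀ q h → 4 * q * h ≡ 2 * (2 * h * q)
      4qh≡2[2hq] = solve-∀

    step : ∀ I → ∣ I ∣ < h → ∃[ i ] i ∉ I × w I * p ≤ a * w (I ∪ ⁅ i ⁆)
    step I ∣I∣<h with greedy-step V (W₀ ∩ ⋂[ I ] V) I {a} {b} {p} (<-≤-trans ∣I∣<h h≤m) (threshold (<⇒≤ ∣I∣<h))
                                  (∈-above⁻ b _ ∘ proj₁ ∘ x∈p∩q⁻ W₀ (⋂[ I ] V))
    ... | i , i∉I , wI*p≤a*∣W∩Vi∣ = i , i∉I , ≤-trans wI*p≤a*∣W∩Vi∣ (*-monoʳ-≤ a (p⊆q⇒∣p∣≤∣q∣ {p = (W₀ ∩ ⋂[ I ] V) ∩ V i} (W∩⋂[I]∩Vi⊆W∩⋂[I∪⁅i⁆] W₀ I V i)))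

    conclude : ∃[ I ] ∣ I ∣ ≡ h × w ⊥ * p ^ h ≤ a ^ h * w I →
               ∃[ I ] ∣ I ∣ ≡ h × p ^ suc h * n ≤ ∣ ⋂[ I ] V ∣ * a ^ suc h
    conclude (I , ∣I∣≡h , w⊥*pʰ≤aʰ*wI) = I , ∣I∣≡h , (begin
      p * p ^ h * n                ≡⟨ xy∙z≈y∙xz p (p ^ h) n ⟩
      p ^ h * (p * n)              ≤⟨ *-monoʳ-≤ (p ^ h) (p*n≤4q*∣above∣ V {p} {q} {{>-nonZero (≤-trans 1≤h h≤m)}} p*n≤∣V∣*q) ⟩
      p ^ h * (a * ∣ W₀ ∣)          ≡⟨ x∙yz≈y∙zx (p ^ h) a ∣ W₀ ∣ ⟩
      a * (∣ W₀ ∣ * p ^ h)          ≤⟨ *-monoʳ-≤ a (*-monoˡ-≤ (p ^ h) ∣W₀∣≤w⊥) ⟩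
      a * (w ⊥ * p ^ h)            ≤⟨ *-monoʳ-≤ a w⊥*pʰ≤aʰ*wI ⟩
      a * (a ^ h * w I)            ≤⟨ *-monoʳ-≤ a (*-monoʳ-≤ (a ^ h) (∣p∩q∣≤∣q∣ W₀ (⋂[ I ] V))) ⟩
      a * (a ^ h * ∣ ⋂[ I ] V ∣)    ≡⟨ x∙yz≈z∙xy a (a ^ h) _ ⟩
      ∣ ⋂[ I ] V ∣ * (a * a ^ h)    ∎)

module Fractions where

  open import Defs
  open import Data.Nat using (ℕ; zero; suc; _*_; _^_) renaming (_≤_ to _≤ℕ_; _<_ to _<ℕ_)
  open import Data.Nat.Properties using (*-identityʳ; +-identityʳ)
  open import Data.Nat.Coprimality using (Coprime)
  open import Data.Integer as ℤ using (+_; +≤+)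
  open import Data.Integer.Properties using (pos-*; drop‿+≤+; drop‿+<+)
  open import Data.Rational using (ℚ; mkℚ; ½; _/_; toℚᵘ; _≤_; _<_) renaming (_*_ to _*ℚ_)
  open import Data.Rational.Properties using (toℚᵘ-homo-*; toℚᵘ-fromℚᵘ; toℚᵘ-mono-≤; toℚᵘ-cancel-≤; toℚᵘ-mono-<)
  open import Data.Rational.Unnormalised as ℚᵘ using (mkℚᵘ; *≤*; *<*; _≃_)
  open import Data.Rational.Unnormalised.Properties using (≃-refl; ≃-reflexive; ≃-trans; ≃-sym; *-cong; ≤-respˡ-≃; ≤-respʳ-≃; <-respˡ-≃; <-respʳ-≃)
  open import Relation.Binary.PropositionalEquality using (sym; trans; cong; cong₂; subst₂)

  -- Fraction x a D says x = a/D through an unnormalised representative, so that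
  -- products and powers of fractions need no gcd reasoning.
  data Fraction (x : ℚ) : ℕ → ℕ → Set where
    fraction : ∀ a d → toℚᵘ x ≃ mkℚᵘ (+ a) d → Fraction x a (suc d)

  fraction-mkℚ : ∀ a d .(c : Coprime a (suc d)) → Fraction (mkℚ (+ a) d c) a (suc d)
  fraction-mkℚ a d c = fraction a d ≃-refl

  fraction-½ : Fraction ½ 1 2
  fraction-½ = fraction 1 1 ≃-refl

  fraction-1/12 : Fraction (+ 1 / 12) 1 12
  fraction-1/12 = fraction 1 11 ≃-refl

  fraction-* : ∀ {x y a b D E} → Fraction x a D → Fraction y b E → Fraction (x *ℚ y) (a * b) (D * E)
  fraction-* {x} {y} (fraction a d x≃) (fraction b e y≃) =
    fraction (a * b) _ (≃-trans (toℚᵘ-homo-* x y) (≃-trans (*-cong x≃ y≃) (≃-reflexive (cong (λ z → mkℚᵘ z _) (sym (pos-* a b))))))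

  fraction-*ℕ→ℚ : ∀ {x a D} k → Fraction x a D → Fraction (x *ℚ ℕ→ℚ k) (a * k) D
  fraction-*ℕ→ℚ {x} k (fraction a d x≃) =
    fraction (a * k) d (≃-trans (toℚᵘ-homo-* x (ℕ→ℚ k)) (≃-trans (*-cong x≃ (toℚᵘ-fromℚᵘ (mkℚᵘ (+ k) 0)))
      (≃-reflexive (cong₂ mkℚᵘ (sym (pos-* a k)) (*-identityʳ d)))))

  fraction-ℕ→ℚ* : ∀ {x a D} k → Fraction x a D → Fraction (ℕ→ℚ k *ℚ x) (k * a) D
  fraction-ℕ→ℚ* {x} k (fraction a d x≃) =
    fraction (k * a) d (≃-trans (toℚᵘ-homo-* (ℕ→ℚ k) x) (≃-trans (*-cong (toℚᵘ-fromℚᵘ (mkℚᵘ (+ k) 0)) x≃)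
      (≃-reflexive (cong₂ mkℚᵘ (sym (pos-* k a)) (+-identityʳ d)))))

  fraction-^ : ∀ {x a D} k → Fraction x a D → Fraction (x ^ℚ k) (a ^ k) (D ^ k)
  fraction-^ zero    _     = fraction 1 0 ≃-refl
  fraction-^ (suc k) x≐a/D = fraction-* x≐a/D (fraction-^ k x≐a/D)

  ≤ℕ→ℚ⁻ : ∀ {x a D} k → Fraction x a D → x ≤ ℕ→ℚ k → a ≤ℕ k * D
  ≤ℕ→ℚ⁻ k (fraction a d x≃) x≤k with ≤-respˡ-≃ x≃ (≤-respʳ-≃ (toℚᵘ-fromℚᵘ (mkℚᵘ (+ k) 0)) (toℚᵘ-mono-≤ x≤k))
  ... | *≤* le = drop‿+≤+ (subst₂ ℤ._≤_ (trans (sym (pos-* a 1)) (cong +_ (*-identityʳ a))) (sym (pos-* k _)) le)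

  ≤ℕ→ℚ⁺ : ∀ {x a D} k → Fraction x a D → a ≤ℕ k * D → x ≤ ℕ→ℚ k
  ≤ℕ→ℚ⁺ k (fraction a d x≃) a≤kD =
    toℚᵘ-cancel-≤ (≤-respˡ-≃ (≃-sym x≃) (≤-respʳ-≃ (≃-sym (toℚᵘ-fromℚᵘ (mkℚᵘ (+ k) 0)))
      (*≤* (subst₂ ℤ._≤_ (trans (cong +_ (sym (*-identityʳ a))) (pos-* a 1)) (pos-* k _) (+≤+ a≤kD)))))

  <-fraction⁻ : ∀ {x y a b D E} → Fraction x a D → Fraction y b E → x < y → a * E <ℕ b * D
  <-fraction⁻ (fraction a d x≃) (fraction b e y≃) x<y with <-respˡ-≃ x≃ (<-respʳ-≃ y≃ (toℚᵘ-mono-< x<y))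
  ... | *<* lt = drop‿+<+ (subst₂ ℤ._<_ (sym (pos-* a _)) (sym (pos-* b _)) lt)

open import Defs
open import Data.Nat using (ℕ; _*_; suc) renaming (_≤_ to _≤ℕ_)
open import Data.Rational using (ℚ; 0ℚ; ½; _<_; _≤_; _÷_; >-nonZero; _/_) renaming (_*_ to _*ℚ_)
open import Data.Integer using (+_)
open import Data.Fin using (Fin)
open import Data.Fin.Subset using (Subset; ∣_∣)
open import Data.Product using (Σ; _×_)
open import Relation.Binary.PropositionalEquality using (_≡_)

open import Data.Integer using (+<+; -[1+_]; +[1+_])
open import Data.Nat using (_^_)
open import Data.Nat.Coprimality as Coprime using ()
open import Data.Nat.Properties using (*-identityʳ; *-identityˡ; *-comm; ≤-trans; ≤-reflexive; <⇒≤; m≤m*n; m≤m+n; ^-monoˡ-≤; *-monoˡ-≤; *-monoʳ-≤; module ≤-Reasoning)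
open import Data.Product using (_,_)
open import Data.Rational using (mkℚ; *<*)
open import Relation.Binary.PropositionalEquality using (cong)

open Counting using (dense-intersection)
open Fractions

lemma7 : (h : ℕ) → 1 ≤ℕ h → (α : ℚ) → (0<α : 0ℚ < α) → α < ½ →
         (n m : ℕ) → (V : Fin m → Subset n) →
         (∀ i → α *ℚ ℕ→ℚ n ≤ ℕ→ℚ ∣ V i ∣) →
         _÷_ (ℕ→ℚ (2 * h)) α {{>-nonZero 0<α}} ≤ ℕ→ℚ m →
         Σ (Subset m) λ I → (∣ I ∣ ≡ h) ×
           (((α *ℚ (+ 1 / 12)) ^ℚ (suc h)) *ℚ ℕ→ℚ n ≤ ℕ→ℚ ∣ ⋂[ I ] V ∣)
lemma7 _ _ (mkℚ (+ 0) _ _) (*<* (+<+ ())) _ _ _ _ _ _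
lemma7 _ _ (mkℚ -[1+ _ ] _ _) (*<* ()) _ _ _ _ _ _
lemma7 h 1≤h (mkℚ +[1+ p-1 ] q-1 c) _ α<½ n m V α*n≤∣V∣ 2h/α≤m =
  conclude (dense-intersection V {h} {p} {q} 1≤h p≤q 2hq≤mp (λ i → ≤ℕ→ℚ⁻ ∣ V i ∣ (fraction-*ℕ→ℚ n α≐p/q) (α*n≤∣V∣ i)))
  where
  p = suc p-1
  q = suc q-1
  α = mkℚ (+ p) q-1 c
  α≐p/q = fraction-mkℚ p q-1 c
  2hq≤mp : 2 * h * q ≤ℕ m * p
  2hq≤mp = ≤ℕ→ℚ⁻ m (fraction-ℕ→ℚ* (2 * h) (fraction-mkℚ q p-1 (Coprime.sym c))) 2h/α≤m
  p≤q : p ≤ℕ q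
  p≤q = ≤-trans (m≤m*n p 2) (≤-trans (<⇒≤ (<-fraction⁻ α≐p/q fraction-½ α<½)) (≤-reflexive (*-identityˡ q)))
  4q≤q*12 : 4 * q ≤ℕ q * 12
  4q≤q*12 = ≤-trans (*-monoˡ-≤ q (m≤m+n 4 8)) (≤-reflexive (*-comm 12 q))
  conclude : Σ (Subset m) (λ I → (∣ I ∣ ≡ h) × p ^ suc h * n ≤ℕ ∣ ⋂[ I ] V ∣ * (4 * q) ^ suc h) →
             Σ (Subset m) λ I → (∣ I ∣ ≡ h) × (((α *ℚ (+ 1 / 12)) ^ℚ (suc h)) *ℚ ℕ→ℚ n ≤ ℕ→ℚ ∣ ⋂[ I ] V ∣)
  conclude (I , ∣I∣≡h , bound) =
    I , ∣I∣≡h , ≤ℕ→ℚ⁺ X (fraction-*ℕ→ℚ n (fraction-^ (suc h) (fraction-* α≐p/q fraction-1/12))) (begin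
      (p * 1) ^ suc h * n   ≡⟨ cong (λ x → x ^ suc h * n) (*-identityʳ p) ⟩
      p ^ suc h * n         ≤⟨ bound ⟩
      X * (4 * q) ^ suc h   ≤⟨ *-monoʳ-≤ X (^-monoˡ-≤ (suc h) 4q≤q*12) ⟩
      X * (q * 12) ^ suc h  ∎)
    where
    open ≤-Reasoning
    X = ∣ ⋂[ I ] V ∣
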